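{- For all positive integers $s$ and $t$, $rb(\mathbb{Z}_{st},1) \leq rb(\mathbb{Z}_s,1)+rb(\mathbb{Z}_t,1)-2$.
   Context: $\mathbb{Z}_n$ denotes the cyclic group of order $n$. An $r$-coloring of $\mathbb{Z}_n$ is a surjective map $c:\mathbb{Z}_n\to\{1,\dots,r\}$. For a fixed integer $k$, a triple is any $(x_1,x_2,x_3)\in\mathbb{Z}_n^3$ with $x_1+x_2\equiv kx_3 \pmod n$. A triple is rainbow under $c$ if $c(x_1),c(x_2),c(x_3)$ are pairwise distinct; $c$ is rainbow-free if no triple is rainbow. The rainbow number $rb(\mathbb{Z}_n,k)$ is the smallest positive integer $r$ such that every $r$-coloring of $\mathbb{Z}_n$ admits a rainbow triple (by convention $rb(\mathbb{Z}_n,k)=n+1$ if no such $r$ exists). -}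

module Defs where

open import Data.Nat using (ℕ; _≤_; _<_)
open import Data.Fin using (Fin; toℕ)
open import Data.Integer as ℤ using (ℤ; +_)
open import Data.Integer.Divisibility using (_∣_)
open import Data.Product using (Σ; ∃; _×_)
open import Relation.Binary.PropositionalEquality using (_≡_; _≢_)
open import Relation.Nullary using (¬_)

-- ℤ_n is represented by Fin n (residues 0 … n-1); colours {1,…,r} by Fin r.

_≡_[mod_] : ℤ → ℤ → ℕ → Set
a ≡ b [mod n ] = (+ n) ∣ (a ℤ.- b)

IsTriple : (n : ℕ) → ℤ → Fin n → Fin n → Fin n → Set
IsTriple n k x₁ x₂ x₃ =
  ((+ toℕ x₁) ℤ.+ (+ toℕ x₂)) ≡ (k ℤ.* (+ toℕ x₃)) [mod n ]

IsColoring : {n r : ℕ} → (Fin n → Fin r) → Set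
IsColoring {n} {r} c = (j : Fin r) → ∃ λ (i : Fin n) → c i ≡ j

HasRainbowTriple : (n : ℕ) → ℤ → {r : ℕ} → (Fin n → Fin r) → Set
HasRainbowTriple n k c =
  Σ (Fin n) λ x₁ → Σ (Fin n) λ x₂ → Σ (Fin n) λ x₃ →
    IsTriple n k x₁ x₂ x₃ × c x₁ ≢ c x₂ × c x₁ ≢ c x₃ × c x₂ ≢ c x₃

EveryColoringRainbow : (n : ℕ) → ℤ → ℕ → Set
EveryColoringRainbow n k r =
  (c : Fin n → Fin r) → IsColoring c → HasRainbowTriple n k c

-- rb(ℤ_n, k) = r : r is the smallest positive integer such that every
-- r-colouring of ℤ_n admits a rainbow triple.  (For r > n there are no
-- r-colourings, so the property holds vacuously at r = n+1; hence this
-- least element always exists and agrees with the convention rb = n+1.)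
IsRainbowNumber : (n : ℕ) → ℤ → ℕ → Set
IsRainbowNumber n k r =
  1 ≤ r × EveryColoringRainbow n k r ×
  ((r′ : ℕ) → 1 ≤ r′ → r′ < r → ¬ EveryColoringRainbow n k r′)

module Submission where

-- For k = 1 the triples of ℤ_n are (x , y , x ⊕ y), ⊕ being addition in ℤ_n.
-- ℤ_s sits in ℤ_{st} as the subgroup ι ℤ_s of multiples of t, and reduction
-- π : ℤ_{st} → ℤ_t has exactly this subgroup as kernel.  Given a rainbow-free
-- colouring col of ℤ_{st}, let A be the colours it uses on the subgroup.
-- col ∘ ι is a rainbow-free colouring of ℤ_s, so |A| < rb(ℤ_s).  In each coset
-- all colours outside A coincide, so colouring a coset by that colour (or by
-- a fresh colour if it has none) gives a rainbow-free colouring of ℤ_t, with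
-- fewer than rb(ℤ_t) colours.  Every colour of col, and the fresh one, occurs
-- in one of the two, so col has at most rb(ℤ_s) + rb(ℤ_t) − 3 colours.

open import Defs
open import Data.Nat using (ℕ; _≤_; _*_; _+_; _∸_)
open import Data.Integer using (+_)

open import Data.Nat using (zero; suc; _<_; _⊓_; z≤n; s≤s; NonZero; >-nonZero; >-nonZero⁻¹)
open import Data.Nat.Properties
open import Data.Nat.DivMod
open import Data.Nat.Divisibility using (_∣_; ∣⇒≤; n∣m*n)
open import Data.Integer as ℤ using (_⊖_)
import Data.Integer.Properties as ℤ
open import Data.Fin using (Fin; zero; suc; toℕ; fromℕ<; inject≤; join; splitAt)
open import Data.Fin.Properties
  using (toℕ-injective; toℕ<n; toℕ-fromℕ<; toℕ-inject≤; toℕ≤pred[n]; splitAt-join; any?; injective⇒≤)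
  renaming (_≟_ to _≟ᶠ_)
open import Data.Product using (∃; _×_; _,_; proj₁; proj₂)
open import Data.Sum using (_⊎_; inj₁; inj₂; [_,_])
open import Function using (_∘_)
open import Relation.Binary.Definitions using (DecidableEquality)
open import Relation.Binary.PropositionalEquality
  using (_≡_; _≢_; refl; sym; trans; cong; cong₂; subst; module ≡-Reasoning)
open import Relation.Nullary using (¬_; Dec; yes; no; ¬?; contradiction)
open import Relation.Nullary.Decidable using (_×-dec_; decidable-stable)

[m%d+n]%d≡[m+n]%d : ∀ m n d .{{_ : NonZero d}} → (m % d + n) % d ≡ (m + n) % d
[m%d+n]%d≡[m+n]%d m n d = begin
  (m % d + n) % d          ≡⟨ %-distribˡ-+ (m % d) n d ⟩
  (m % d % d + n % d) % d  ≡⟨ cong (λ v → (v + n % d) % d) (m%n%n≡m%n m d) ⟩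
  (m % d + n % d) % d      ≡⟨ %-distribˡ-+ m n d ⟨
  (m + n) % d              ∎
  where open ≡-Reasoning

[m+n%d]%d≡[m+n]%d : ∀ m n d .{{_ : NonZero d}} → (m + n % d) % d ≡ (m + n) % d
[m+n%d]%d≡[m+n]%d m n d = begin
  (m + n % d) % d  ≡⟨ cong (_% d) (+-comm m (n % d)) ⟩
  (n % d + m) % d  ≡⟨ [m%d+n]%d≡[m+n]%d n m d ⟩
  (n + m) % d      ≡⟨ cong (_% d) (+-comm n m) ⟩
  (m + n) % d      ∎
  where open ≡-Reasoning

∣⊖∣⇒% : ∀ {n m c} .{{_ : NonZero n}} → c < n → n ∣ ℤ.∣ m ⊖ c ∣ → m % n ≡ c
∣⊖∣⇒% {n} {m} {c} c<n n∣m-c with c ≤? m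
... | yes c≤m = begin
  m % n            ≡⟨ cong (_% n) (m∸n+n≡m c≤m) ⟨
  (m ∸ c + c) % n  ≡⟨ %-remove-+ˡ c (subst (n ∣_) (cong ℤ.∣_∣ (ℤ.⊖-≥ c≤m)) n∣m-c) ⟩
  c % n            ≡⟨ m<n⇒m%n≡m c<n ⟩
  c                ∎
  where open ≡-Reasoning
... | no c≰m = contradiction (∣⇒≤ {{>-nonZero (m<n⇒0<n∸m m<c)}} n∣c∸m) (<⇒≱ c∸m<n)
  where
  m<c : m < c
  m<c = ≰⇒> c≰m
  n∣c∸m : n ∣ c ∸ m
  n∣c∸m = subst (n ∣_) (ℤ.∣⊖∣-< m<c) n∣m-c
  c∸m<n : c ∸ m < n
  c∸m<n = ≤-<-trans (m∸n≤m c m) c<n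

%⇒∣⊖∣ : ∀ {n m c} .{{_ : NonZero n}} → m % n ≡ c → n ∣ ℤ.∣ m ⊖ c ∣
%⇒∣⊖∣ {n} {m} refl = subst (n ∣_) (sym ∣m⊖m%n∣≡m/n*n) (n∣m*n (m / n))
  where
  ∣m⊖m%n∣≡m/n*n : ℤ.∣ m ⊖ m % n ∣ ≡ m / n * n
  ∣m⊖m%n∣≡m/n*n = trans (cong ℤ.∣_∣ (ℤ.⊖-≥ (m%n≤m m n)))
    (trans (cong (_∸ m % n) (m≡m%n+[m/n]*n m n)) (m+n∸m≡n (m % n) (m / n * n)))

triple-difference : ∀ a b c → ℤ.∣ (+ a ℤ.+ + b) ℤ.- (+ 1 ℤ.* + c) ∣ ≡ ℤ.∣ (a + b) ⊖ c ∣
triple-difference a b c =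
  trans (cong (λ v → ℤ.∣ + (a + b) ℤ.- v ∣) (ℤ.*-identityˡ (+ c)))
        (cong ℤ.∣_∣ (ℤ.m-n≡m⊖n (a + b) c))

module _ {n : ℕ} .{{_ : NonZero n}} where
  infixl 6 _⊕_

  _⊕_ : Fin n → Fin n → Fin n
  x ⊕ y = (toℕ x + toℕ y) mod n

  𝟎 : Fin n
  𝟎 = 0 mod n

  negate : Fin n → Fin n
  negate x = (n ∸ toℕ x) mod n

  toℕ-⊕ : ∀ x y → toℕ (x ⊕ y) ≡ (toℕ x + toℕ y) % n
  toℕ-⊕ x y = toℕ-fromℕ< (m%n<n (toℕ x + toℕ y) n)

  toℕ-𝟎 : toℕ 𝟎 ≡ 0
  toℕ-𝟎 = trans (toℕ-fromℕ< (m%n<n 0 n)) (m<n⇒m%n≡m (>-nonZero⁻¹ n))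

  isTriple⇒⊕ : ∀ {x y z} → IsTriple n (+ 1) x y z → x ⊕ y ≡ z
  isTriple⇒⊕ {x} {y} {z} n∣ = toℕ-injective (trans (toℕ-⊕ x y)
    (∣⊖∣⇒% (toℕ<n z) (subst (n ∣_) (triple-difference (toℕ x) (toℕ y) (toℕ z)) n∣)))

  ⊕⇒isTriple : ∀ {x y z} → x ⊕ y ≡ z → IsTriple n (+ 1) x y z
  ⊕⇒isTriple {x = x} {y = y} refl =
    subst (n ∣_) (sym (triple-difference (toℕ x) (toℕ y) (toℕ (x ⊕ y))))
      (%⇒∣⊖∣ (sym (toℕ-⊕ x y)))

  ⊕-comm : ∀ x y → x ⊕ y ≡ y ⊕ x
  ⊕-comm x y = cong (_mod n) (+-comm (toℕ x) (toℕ y))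

  ⊕-identityˡ : ∀ x → 𝟎 ⊕ x ≡ x
  ⊕-identityˡ x = toℕ-injective (begin
    toℕ (𝟎 ⊕ x)              ≡⟨ toℕ-⊕ 𝟎 x ⟩
    (toℕ 𝟎 + toℕ x) % n      ≡⟨ cong (λ v → (v + toℕ x) % n) toℕ-𝟎 ⟩
    toℕ x % n                ≡⟨ m<n⇒m%n≡m (toℕ<n x) ⟩
    toℕ x                    ∎)
    where open ≡-Reasoning

  -- x and negate x add up to n, which vanishes modulo n.
  private
    x+negate-x : ∀ y x → (toℕ y + toℕ x + toℕ (negate x)) % n ≡ toℕ y
    x+negate-x y x = begin
      (toℕ y + toℕ x + toℕ (negate x)) % n ≡⟨ cong (λ v → (toℕ y + toℕ x + v) % n)
                                                   (toℕ-fromℕ< (m%n<n (n ∸ toℕ x) n)) ⟩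
      (toℕ y + toℕ x + (n ∸ toℕ x) % n) % n ≡⟨ [m+n%d]%d≡[m+n]%d (toℕ y + toℕ x) (n ∸ toℕ x) n ⟩
      (toℕ y + toℕ x + (n ∸ toℕ x)) % n     ≡⟨ cong (_% n) (+-assoc (toℕ y) (toℕ x) (n ∸ toℕ x)) ⟩
      (toℕ y + (toℕ x + (n ∸ toℕ x))) % n   ≡⟨ cong (λ v → (toℕ y + v) % n) (m+[n∸m]≡n (<⇒≤ (toℕ<n x))) ⟩
      (toℕ y + n) % n                       ≡⟨ [m+n]%n≡m%n (toℕ y) n ⟩
      toℕ y % n                             ≡⟨ m<n⇒m%n≡m (toℕ<n y) ⟩
      toℕ y                                 ∎
      where open ≡-Reasoning

    toℕ-⊕⊕ : ∀ x y z → toℕ ((x ⊕ y) ⊕ z) ≡ (toℕ x + toℕ y + toℕ z) % n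
    toℕ-⊕⊕ x y z = trans (toℕ-⊕ (x ⊕ y) z)
      (trans (cong (λ v → (v + toℕ z) % n) (toℕ-⊕ x y)) ([m%d+n]%d≡[m+n]%d (toℕ x + toℕ y) (toℕ z) n))

  ⊕-negate-cancel : ∀ y x → (y ⊕ x) ⊕ negate x ≡ y
  ⊕-negate-cancel y x = toℕ-injective (trans (toℕ-⊕⊕ y x (negate x)) (x+negate-x y x))

  negate-⊕-cancel : ∀ y x → (y ⊕ negate x) ⊕ x ≡ y
  negate-⊕-cancel y x = toℕ-injective (begin
    toℕ ((y ⊕ negate x) ⊕ x)                ≡⟨ toℕ-⊕⊕ y (negate x) x ⟩
    (toℕ y + toℕ (negate x) + toℕ x) % n    ≡⟨ cong (_% n) (+-assoc (toℕ y) (toℕ (negate x)) (toℕ x)) ⟩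
    (toℕ y + (toℕ (negate x) + toℕ x)) % n  ≡⟨ cong (λ v → (toℕ y + v) % n) (+-comm (toℕ (negate x)) (toℕ x)) ⟩
    (toℕ y + (toℕ x + toℕ (negate x))) % n  ≡⟨ cong (_% n) (+-assoc (toℕ y) (toℕ x) (toℕ (negate x))) ⟨
    (toℕ y + toℕ x + toℕ (negate x)) % n    ≡⟨ x+negate-x y x ⟩
    toℕ y                                   ∎)
    where open ≡-Reasoning

  ⊕-cancelʳ : ∀ {x y z} → y ⊕ x ≡ z ⊕ x → y ≡ z
  ⊕-cancelʳ {x} {y} {z} y⊕x≡z⊕x = begin
    y                     ≡⟨ ⊕-negate-cancel y x ⟨
    (y ⊕ x) ⊕ negate x    ≡⟨ cong (_⊕ negate x) y⊕x≡z⊕x ⟩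
    (z ⊕ x) ⊕ negate x    ≡⟨ ⊕-negate-cancel z x ⟩
    z                     ∎
    where open ≡-Reasoning

Rainbow : {A : Set} → A → A → A → Set
Rainbow a b c = a ≢ b × a ≢ c × b ≢ c

rainbow? : ∀ {r} (a b c : Fin r) → Dec (Rainbow a b c)
rainbow? a b c = ¬? (a ≟ᶠ b) ×-dec ¬? (a ≟ᶠ c) ×-dec ¬? (b ≟ᶠ c)

rainbow-swap : ∀ {A : Set} {a b c : A} → Rainbow a b c → Rainbow b a c
rainbow-swap (a≢b , a≢c , b≢c) = a≢b ∘ sym , b≢c , a≢c

rainbowTriple-refine : ∀ {n k r r′} {f : Fin n → Fin r} {g : Fin n → Fin r′} →
                       (∀ {u v} → f u ≡ f v → g u ≡ g v) →
                       HasRainbowTriple n k g → HasRainbowTriple n k f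
rainbowTriple-refine f⇒g (x , y , z , triple , gx≢gy , gx≢gz , gy≢gz) =
  x , y , z , triple , gx≢gy ∘ f⇒g , gx≢gz ∘ f⇒g , gy≢gz ∘ f⇒g

RainbowFree : ∀ {n r} .{{_ : NonZero n}} → (Fin n → Fin r) → Set
RainbowFree c = ∀ x y → ¬ Rainbow (c x) (c y) (c (x ⊕ y))

module _ {n r : ℕ} .{{_ : NonZero n}} where
  rainbowFree⇒¬triple : {c : Fin n → Fin r} → RainbowFree c → ¬ HasRainbowTriple n (+ 1) c
  rainbowFree⇒¬triple {c} free (x , y , z , triple , rainbow) =
    free x y (subst (λ w → Rainbow (c x) (c y) (c w)) (sym (isTriple⇒⊕ {x = x} {y = y} {z = z} triple)) rainbow)

  rainbow-dichotomy : (c : Fin n → Fin r) → HasRainbowTriple n (+ 1) c ⊎ RainbowFree c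
  rainbow-dichotomy c with any? (λ x → any? (λ y → rainbow? (c x) (c y) (c (x ⊕ y))))
  ... | yes (x , y , rainbow) = inj₁ (x , y , x ⊕ y , ⊕⇒isTriple {x = x} {y = y} refl , rainbow)
  ... | no none               = inj₂ (λ x y rainbow → none (x , y , rainbow))

clamp : ∀ {m} a → Fin m → Fin (suc a)
clamp a x = fromℕ< (s≤s (m⊓n≤n (toℕ x) a))

clamp-onto : ∀ {a m} → suc a ≤ m → IsColoring (clamp {m} a)
clamp-onto {a} a<m j = inject≤ j a<m , toℕ-injective (begin
  toℕ (clamp a (inject≤ j a<m)) ≡⟨ toℕ-fromℕ< (s≤s (m⊓n≤n (toℕ (inject≤ j a<m)) a)) ⟩
  toℕ (inject≤ j a<m) ⊓ a       ≡⟨ cong (_⊓ a) (toℕ-inject≤ j a<m) ⟩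
  toℕ j ⊓ a                     ≡⟨ m≤n⇒m⊓n≡m (toℕ≤pred[n] j) ⟩
  toℕ j                         ∎)
  where open ≡-Reasoning

everyColoringRainbow-mono : ∀ {n k a m} → 1 ≤ a → a ≤ m →
                            EveryColoringRainbow n k a → EveryColoringRainbow n k m
everyColoringRainbow-mono {k = k} {a = suc a} _ a≤m every c c-onto =
  rainbowTriple-refine {k = k} {f = c} (cong (clamp a)) (every (clamp a ∘ c) clamp∘c-onto)
  where
  clamp∘c-onto : IsColoring (clamp a ∘ c)
  clamp∘c-onto j =
    let (v , v↦j) = clamp-onto a≤m j
        (x , x↦v) = c-onto v
    in x , trans (cong (clamp a) x↦v) v↦j

record Image {n : ℕ} {B : Set} (f : Fin n → B) : Set where
  field
    size           : ℕ
    elem           : Fin size → B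
    index          : Fin n → Fin size
    elem-injective : ∀ {i j} → elem i ≡ elem j → i ≡ j
    elem-index     : ∀ x → elem (index x) ≡ f x
    index-onto     : IsColoring index

  index-cong : ∀ {x y} → f x ≡ f y → index x ≡ index y
  index-cong {x} {y} fx≡fy =
    elem-injective (trans (elem-index x) (trans fx≡fy (sym (elem-index y))))

module _ {B : Set} (_≟B_ : DecidableEquality B) where
  private
    image-old : ∀ {n} {f : Fin (suc n) → B} (I : Image (f ∘ suc)) (i : Fin (Image.size I)) →
                Image.elem I i ≡ f zero → Image f
    image-old {n} {f} I i i↦f0 = record
      { size = size ; elem = elem ; index = index′ ; elem-injective = elem-injective
      ; elem-index = elem-index′ ; index-onto = index′-onto }
      where
      open Image I
      index′ : Fin (suc n) → Fin size
      index′ zero    = i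
      index′ (suc x) = index x
      elem-index′ : ∀ x → elem (index′ x) ≡ f x
      elem-index′ zero    = i↦f0
      elem-index′ (suc x) = elem-index x
      index′-onto : IsColoring index′
      index′-onto j = let (x , x↦j) = index-onto j in suc x , x↦j

    image-new : ∀ {n} {f : Fin (suc n) → B} (I : Image (f ∘ suc)) →
                (∀ i → Image.elem I i ≢ f zero) → Image f
    image-new {n} {f} I fresh = record
      { size = suc size ; elem = elem′ ; index = index′ ; elem-injective = elem′-injective
      ; elem-index = elem-index′ ; index-onto = index′-onto }
      where
      open Image I
      elem′ : Fin (suc size) → B
      elem′ zero    = f zero
      elem′ (suc i) = elem i
      index′ : Fin (suc n) → Fin (suc size)
      index′ zero    = zero
      index′ (suc x) = suc (index x)
      elem′-injective : ∀ {i j} → elem′ i ≡ elem′ j → i ≡ j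
      elem′-injective {zero}  {zero}  _ = refl
      elem′-injective {zero}  {suc j} e = contradiction (sym e) (fresh j)
      elem′-injective {suc i} {zero}  e = contradiction e (fresh i)
      elem′-injective {suc i} {suc j} e = cong suc (elem-injective e)
      elem-index′ : ∀ x → elem′ (index′ x) ≡ f x
      elem-index′ zero    = refl
      elem-index′ (suc x) = elem-index x
      index′-onto : IsColoring index′
      index′-onto zero    = zero , refl
      index′-onto (suc j) = let (x , x↦j) = index-onto j in suc x , cong suc x↦j

  image : ∀ {n} (f : Fin n → B) → Image f
  image {zero} f = record
    { size = 0 ; elem = λ () ; index = λ () ; elem-injective = λ { {()} }
    ; elem-index = λ () ; index-onto = λ () }
  image {suc n} f = extend (image (f ∘ suc))
    where
    extend : Image (f ∘ suc) → Image f
    extend I with any? (λ i → Image.elem I i ≟B f zero)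
    ... | yes (i , i↦f0) = image-old I i i↦f0
    ... | no fresh       = image-new I (λ i i↦f0 → fresh (i , i↦f0))

image-size< : ∀ {n r a} .{{_ : NonZero n}} → 1 ≤ a → EveryColoringRainbow n (+ 1) a →
              (c : Fin n → Fin r) → RainbowFree c → Image.size (image _≟ᶠ_ c) < a
image-size< 1≤a every c free = ≰⇒> λ a≤size →
  rainbowFree⇒¬triple free (rainbowTriple-refine {k = + 1} {f = c} index-cong
    (everyColoringRainbow-mono {k = + 1} 1≤a a≤size every index index-onto))
  where open Image (image _≟ᶠ_ c)

surjection⇒≤ : ∀ {p q m} (h : Fin p ⊎ Fin q → Fin m) → (∀ j → ∃ λ z → h z ≡ j) → m ≤ p + q
surjection⇒≤ {p} {q} h h-onto = injective⇒≤ section-injective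
  where
  section : ∀ j → Fin p ⊎ Fin q
  section j = proj₁ (h-onto j)
  section-injective : ∀ {i j} → join p q (section i) ≡ join p q (section j) → i ≡ j
  section-injective {i} {j} e = begin
    i                                       ≡⟨ proj₂ (h-onto i) ⟨
    h (section i)                           ≡⟨ cong h (splitAt-join p q (section i)) ⟨
    h (splitAt p (join p q (section i)))    ≡⟨ cong (h ∘ splitAt p) e ⟩
    h (splitAt p (join p q (section j)))    ≡⟨ cong h (splitAt-join p q (section j)) ⟩
    h (section j)                           ≡⟨ proj₂ (h-onto j) ⟩
    j                                       ∎
    where open ≡-Reasoning

sum-bound : ∀ {a b p q} → p < a → q < b → p + q ≤ a + b ∸ 2
sum-bound {a = suc a} {b = suc b} {p} {q} (s≤s p≤a) (s≤s q≤b) = begin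
  p + q          ≤⟨ +-mono-≤ p≤a q≤b ⟩
  a + b          ≡⟨ cong (_∸ 1) (+-suc a b) ⟨
  a + suc b ∸ 1  ∎
  where open ≤-Reasoning

module _ {s t : ℕ} .{{_ : NonZero s}} .{{_ : NonZero t}} where
  private
    instance
      st-nonZero : NonZero (s * t)
      st-nonZero = m*n≢0 s t

  ι : Fin s → Fin (s * t)
  ι i = fromℕ< (*-monoˡ-< t (toℕ<n i))

  π : Fin (s * t) → Fin t
  π x = toℕ x mod t

  toℕ-ι : ∀ i → toℕ (ι i) ≡ toℕ i * t
  toℕ-ι i = toℕ-fromℕ< (*-monoˡ-< t (toℕ<n i))

  toℕ-π : ∀ x → toℕ (π x) ≡ toℕ x % t
  toℕ-π x = toℕ-fromℕ< (m%n<n (toℕ x) t)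

  ι-hom : ∀ i j → ι (i ⊕ j) ≡ ι i ⊕ ι j
  ι-hom i j = toℕ-injective (begin
    toℕ (ι (i ⊕ j))                    ≡⟨ toℕ-ι (i ⊕ j) ⟩
    toℕ (i ⊕ j) * t                    ≡⟨ cong (_* t) (toℕ-⊕ i j) ⟩
    (toℕ i + toℕ j) % s * t            ≡⟨ m%n*o≡m*o%[n*o] (toℕ i + toℕ j) s t ⟩
    (toℕ i + toℕ j) * t % (s * t)      ≡⟨ cong (_% (s * t)) (*-distribʳ-+ t (toℕ i) (toℕ j)) ⟩
    (toℕ i * t + toℕ j * t) % (s * t)  ≡⟨ cong₂ (λ u v → (u + v) % (s * t)) (toℕ-ι i) (toℕ-ι j) ⟨
    (toℕ (ι i) + toℕ (ι j)) % (s * t)  ≡⟨ toℕ-⊕ (ι i) (ι j) ⟨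
    toℕ (ι i ⊕ ι j)                    ∎)
    where open ≡-Reasoning

  π-hom : ∀ x y → π (x ⊕ y) ≡ π x ⊕ π y
  π-hom x y = toℕ-injective (begin
    toℕ (π (x ⊕ y))                ≡⟨ toℕ-π (x ⊕ y) ⟩
    toℕ (x ⊕ y) % t                ≡⟨ cong (_% t) (toℕ-⊕ x y) ⟩
    (toℕ x + toℕ y) % (s * t) % t  ≡⟨ m∣n⇒o%n%m≡o%m t (s * t) (toℕ x + toℕ y) (n∣m*n s) ⟩
    (toℕ x + toℕ y) % t            ≡⟨ %-distribˡ-+ (toℕ x) (toℕ y) t ⟩
    (toℕ x % t + toℕ y % t) % t    ≡⟨ cong₂ (λ u v → (u + v) % t) (toℕ-π x) (toℕ-π y) ⟨
    (toℕ (π x) + toℕ (π y)) % t    ≡⟨ toℕ-⊕ (π x) (π y) ⟨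
    toℕ (π x ⊕ π y)                ∎)
    where open ≡-Reasoning

  π-kernel : ∀ x → π x ≡ 𝟎 → ∃ λ i → ι i ≡ x
  π-kernel x πx≡𝟎 = fromℕ< q<s , toℕ-injective (begin
    toℕ (ι (fromℕ< q<s))        ≡⟨ toℕ-ι (fromℕ< q<s) ⟩
    toℕ (fromℕ< q<s) * t        ≡⟨ cong (_* t) (toℕ-fromℕ< q<s) ⟩
    toℕ x / t * t               ≡⟨ cong (_+ toℕ x / t * t) x%t≡0 ⟨
    toℕ x % t + toℕ x / t * t   ≡⟨ m≡m%n+[m/n]*n (toℕ x) t ⟨
    toℕ x                       ∎)
    where
    open ≡-Reasoning
    q<s : toℕ x / t < s
    q<s = m<n*o⇒m/o<n (toℕ<n x)
    x%t≡0 : toℕ x % t ≡ 0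
    x%t≡0 = trans (sym (toℕ-π x)) (trans (cong toℕ πx≡𝟎) toℕ-𝟎)

  same-coset : ∀ {x y} → π x ≡ π y → ∃ λ i → x ⊕ ι i ≡ y
  same-coset {x} {y} πx≡πy = i , (begin
    x ⊕ ι i  ≡⟨ cong (x ⊕_) ιi≡h ⟩
    x ⊕ h    ≡⟨ ⊕-comm x h ⟩
    h ⊕ x    ≡⟨ negate-⊕-cancel y x ⟩
    y        ∎)
    where
    open ≡-Reasoning
    h : Fin (s * t)
    h = y ⊕ negate x
    πh≡𝟎 : π h ≡ 𝟎
    πh≡𝟎 = ⊕-cancelʳ (begin
      π h ⊕ π x  ≡⟨ π-hom h x ⟨
      π (h ⊕ x)  ≡⟨ cong π (negate-⊕-cancel y x) ⟩
      π y        ≡⟨ πx≡πy ⟨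
      π x        ≡⟨ ⊕-identityˡ (π x) ⟨
      𝟎 ⊕ π x    ∎)
    i : Fin s
    i = proj₁ (π-kernel h πh≡𝟎)
    ιi≡h : ι i ≡ h
    ιi≡h = proj₂ (π-kernel h πh≡𝟎)

  module RainbowFreeColouring {r : ℕ} (col : Fin (s * t) → Fin r) (free : RainbowFree col) where
    InA : Fin r → Set
    InA j = ∃ λ i → col (ι i) ≡ j

    inA? : ∀ j → Dec (InA j)
    inA? j = any? (λ i → col (ι i) ≟ᶠ j)

    inA-differ : ∀ {a b} → InA a → ¬ InA b → a ≢ b
    inA-differ a∈A b∉A refl = b∉A a∈A

    subgroup-free : RainbowFree (col ∘ ι)
    subgroup-free i j rainbow =
      free (ι i) (ι j) (subst (λ z → Rainbow (col (ι i)) (col (ι j)) (col z)) (ι-hom i j) rainbow)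

    -- Within one coset, all elements coloured outside A have the same colour:
    -- x, the connecting subgroup element and y would otherwise form a rainbow.
    coset-colour-unique : ∀ {x y} → π x ≡ π y → ¬ InA (col x) → ¬ InA (col y) → col x ≡ col y
    coset-colour-unique {x} {y} πx≡πy x∉A y∉A with col x ≟ᶠ col y
    ... | yes same = same
    ... | no differ =
      let (i , x⊕ιi≡y) = same-coset πx≡πy
      in contradiction
           (subst (λ z → Rainbow (col x) (col (ι i)) (col z)) (sym x⊕ιi≡y)
             (inA-differ (i , refl) x∉A ∘ sym , differ , inA-differ (i , refl) y∉A))
           (free x (ι i))

    Pure : Fin t → Set
    Pure u = ∀ x → π x ≡ u → InA (col x)

    Impure : Fin t → Set
    Impure u = ∃ λ x → π x ≡ u × ¬ InA (col x)

    impure? : ∀ u → Dec (Impure u)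
    impure? u = any? (λ x → (π x ≟ᶠ u) ×-dec ¬? (inA? (col x)))

    pure-or-impure : ∀ u → Pure u ⊎ Impure u
    pure-or-impure u with impure? u
    ... | yes impure = inj₂ impure
    ... | no ¬impure = inj₁ λ x πx≡u →
      decidable-stable (inA? (col x)) (λ x∉A → ¬impure (x , πx≡u , x∉A))

    cosetColour : Fin t → Fin (suc r)
    cosetColour u with impure? u
    ... | yes (x , _) = suc (col x)
    ... | no _        = zero

    cosetColour-pure : ∀ {u} → Pure u → cosetColour u ≡ zero
    cosetColour-pure {u} pure with impure? u
    ... | yes (x , πx≡u , x∉A) = contradiction (pure x πx≡u) x∉A
    ... | no _                 = refl

    cosetColour-impure : ∀ {u x} → π x ≡ u → ¬ InA (col x) → cosetColour u ≡ suc (col x)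
    cosetColour-impure {u} {x} πx≡u x∉A with impure? u
    ... | yes (y , πy≡u , y∉A) = cong suc (coset-colour-unique (trans πy≡u (sym πx≡u)) y∉A x∉A)
    ... | no ¬impure           = contradiction (x , πx≡u , x∉A) ¬impure

    colours-differ : ∀ {u v a b} → cosetColour u ≡ suc a → cosetColour v ≡ suc b →
                     cosetColour u ≢ cosetColour v → a ≢ b
    colours-differ cu≡a cv≡b cu≢cv a≡b = cu≢cv (trans cu≡a (trans (cong suc a≡b) (sym cv≡b)))

    -- If u₁ is pure, a rainbow u₁, u₂, u₁ ⊕ u₂ makes the other two cosets impure;
    -- solving x₁ ⊕ x₂ ≡ x₃ for their witnesses puts x₁ in u₁, and x₁, x₂ is a rainbow.
    pure-no-rainbow : ∀ {u₁} u₂ → Pure u₁ →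
                      ¬ Rainbow (cosetColour u₁) (cosetColour u₂) (cosetColour (u₁ ⊕ u₂))
    pure-no-rainbow {u₁} u₂ pure₁ (c₁≢c₂ , c₁≢c₃ , c₂≢c₃)
      with pure-or-impure u₂ | pure-or-impure (u₁ ⊕ u₂)
    ... | inj₁ pure₂ | _ = c₁≢c₂ (trans (cosetColour-pure pure₁) (sym (cosetColour-pure pure₂)))
    ... | inj₂ _ | inj₁ pure₃ = c₁≢c₃ (trans (cosetColour-pure pure₁) (sym (cosetColour-pure pure₃)))
    ... | inj₂ (x₂ , πx₂≡u₂ , x₂∉A) | inj₂ (x₃ , πx₃≡u₃ , x₃∉A) =
      free x₁ x₂ (subst (λ z → Rainbow (col x₁) (col x₂) (col z)) (sym x₁⊕x₂≡x₃)
        ( inA-differ x₁∈A x₂∉A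
        , inA-differ x₁∈A x₃∉A
        , colours-differ (cosetColour-impure πx₂≡u₂ x₂∉A) (cosetColour-impure πx₃≡u₃ x₃∉A) c₂≢c₃ ))
      where
      open ≡-Reasoning
      x₁ : Fin (s * t)
      x₁ = x₃ ⊕ negate x₂
      x₁⊕x₂≡x₃ : x₁ ⊕ x₂ ≡ x₃
      x₁⊕x₂≡x₃ = negate-⊕-cancel x₃ x₂
      πx₁≡u₁ : π x₁ ≡ u₁
      πx₁≡u₁ = ⊕-cancelʳ (begin
        π x₁ ⊕ u₂      ≡⟨ cong (π x₁ ⊕_) πx₂≡u₂ ⟨
        π x₁ ⊕ π x₂    ≡⟨ π-hom x₁ x₂ ⟨
        π (x₁ ⊕ x₂)    ≡⟨ cong π x₁⊕x₂≡x₃ ⟩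
        π x₃           ≡⟨ πx₃≡u₃ ⟩
        u₁ ⊕ u₂        ∎)
      x₁∈A : InA (col x₁)
      x₁∈A = pure₁ x₁ πx₁≡u₁

    -- If u₁ and u₂ are impure with witnesses x₁, x₂, then x₁, x₂, x₁ ⊕ x₂ is a rainbow.
    impure-no-rainbow : ∀ {u₁ u₂} → Impure u₁ → Impure u₂ →
                        ¬ Rainbow (cosetColour u₁) (cosetColour u₂) (cosetColour (u₁ ⊕ u₂))
    impure-no-rainbow {u₁} {u₂} (x₁ , πx₁≡u₁ , x₁∉A) (x₂ , πx₂≡u₂ , x₂∉A) (c₁≢c₂ , c₁≢c₃ , c₂≢c₃) =
      free x₁ x₂ rainbow
      where
      c₁ : cosetColour u₁ ≡ suc (col x₁)
      c₁ = cosetColour-impure πx₁≡u₁ x₁∉A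
      c₂ : cosetColour u₂ ≡ suc (col x₂)
      c₂ = cosetColour-impure πx₂≡u₂ x₂∉A
      πx₃≡u₃ : π (x₁ ⊕ x₂) ≡ u₁ ⊕ u₂
      πx₃≡u₃ = trans (π-hom x₁ x₂) (cong₂ _⊕_ πx₁≡u₁ πx₂≡u₂)
      rainbow : Rainbow (col x₁) (col x₂) (col (x₁ ⊕ x₂))
      rainbow with inA? (col (x₁ ⊕ x₂))
      ... | yes x₃∈A = colours-differ c₁ c₂ c₁≢c₂ , inA-differ x₃∈A x₁∉A ∘ sym , inA-differ x₃∈A x₂∉A ∘ sym
      ... | no x₃∉A  = colours-differ c₁ c₂ c₁≢c₂ , colours-differ c₁ c₃ c₁≢c₃ , colours-differ c₂ c₃ c₂≢c₃
        where
        c₃ : cosetColour (u₁ ⊕ u₂) ≡ suc (col (x₁ ⊕ x₂))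
        c₃ = cosetColour-impure πx₃≡u₃ x₃∉A

    cosetColour-free : RainbowFree cosetColour
    cosetColour-free u₁ u₂ rainbow with pure-or-impure u₁ | pure-or-impure u₂
    ... | inj₁ pure₁   | _            = pure-no-rainbow u₂ pure₁ rainbow
    ... | inj₂ _       | inj₁ pure₂   = pure-no-rainbow u₁ pure₂
      (subst (λ w → Rainbow (cosetColour u₂) (cosetColour u₁) (cosetColour w)) (⊕-comm u₁ u₂)
        (rainbow-swap rainbow))
    ... | inj₂ impure₁ | inj₂ impure₂ = impure-no-rainbow impure₁ impure₂ rainbow

    -- When col is onto, each colour of Fin (suc r) is suc of a colour on the
    -- subgroup or a coset colour; zero is the colour of the pure coset 𝟎.
    colours-covered : IsColoring col → ∀ j →
                      (∃ λ i → suc (col (ι i)) ≡ j) ⊎ (∃ λ u → cosetColour u ≡ j)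
    colours-covered _ zero = inj₂ (𝟎 , cosetColour-pure subgroup-pure)
      where
      subgroup-pure : Pure 𝟎
      subgroup-pure x πx≡𝟎 = let (i , ιi≡x) = π-kernel x πx≡𝟎 in i , cong col ιi≡x
    colours-covered col-onto (suc j) with inA? j
    ... | yes (i , ιi↦j) = inj₁ (i , cong suc ιi↦j)
    ... | no j∉A =
      let (x , x↦j) = col-onto j
      in inj₂ (π x , trans (cosetColour-impure refl (subst (¬_ ∘ InA) (sym x↦j) j∉A)) (cong suc x↦j))

    colour-count : IsColoring col →
                   suc r ≤ Image.size (image _≟ᶠ_ (col ∘ ι)) + Image.size (image _≟ᶠ_ cosetColour)
    colour-count col-onto = surjection⇒≤ [ suc ∘ Iₛ.elem , Iₜ.elem ] covered
      where
      module Iₛ = Image (image _≟ᶠ_ (col ∘ ι))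
      module Iₜ = Image (image _≟ᶠ_ cosetColour)
      covered : ∀ j → ∃ λ z → [ suc ∘ Iₛ.elem , Iₜ.elem ] z ≡ j
      covered j with colours-covered col-onto j
      ... | inj₁ (i , i↦j) = inj₁ (Iₛ.index i) , trans (cong suc (Iₛ.elem-index i)) i↦j
      ... | inj₂ (u , u↦j) = inj₂ (Iₜ.index u) , trans (Iₜ.elem-index u) u↦j

  -- Proposition 3 for colourings: if every a-colouring of ℤ_s and every
  -- b-colouring of ℤ_t has a rainbow triple, so does every (a + b − 2)-colouring
  -- of ℤ_{st}, since a rainbow-free one would have too many colours.
  product-rainbow : ∀ {a b} → 1 ≤ a → 1 ≤ b →
                    EveryColoringRainbow s (+ 1) a → EveryColoringRainbow t (+ 1) b →
                    EveryColoringRainbow (s * t) (+ 1) (a + b ∸ 2)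
  product-rainbow {a} {b} 1≤a 1≤b everyₛ everyₜ col col-onto with rainbow-dichotomy col
  ... | inj₁ rainbow = rainbow
  ... | inj₂ free = contradiction (≤-trans (colour-count col-onto) (sum-bound subgroup-bound coset-bound))
                                  (n≮n (a + b ∸ 2))
    where
    open RainbowFreeColouring col free
    subgroup-bound : Image.size (image _≟ᶠ_ (col ∘ ι)) < a
    subgroup-bound = image-size< 1≤a everyₛ (col ∘ ι) subgroup-free
    coset-bound : Image.size (image _≟ᶠ_ cosetColour) < b
    coset-bound = image-size< 1≤b everyₜ cosetColour cosetColour-free

-- rb(ℤ_n, k) ≥ 2 for n ≥ 1: a single colour gives no rainbow.
rainbowNumber≥2 : ∀ {n k a} → 1 ≤ n → IsRainbowNumber n k a → 2 ≤ a
rainbowNumber≥2 {a = zero}          _   (() , _)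
rainbowNumber≥2 {a = suc zero}      1≤n (_ , every , _) =
  let (_ , _ , _ , _ , x≢y , _) = every (λ _ → zero) (λ { zero → fromℕ< 1≤n , refl })
  in contradiction refl x≢y
rainbowNumber≥2 {a = suc (suc _)}   _   _ = s≤s (s≤s z≤n)

-- rb(ℤ_{st}) ≤ a + b − 2 by minimality, as a + b − 2 ≥ 1 (using a ≥ 2).
proposition3 : (s t : ℕ) → 1 ≤ s → 1 ≤ t →
    (a b c : ℕ) →
    IsRainbowNumber s (+ 1) a →
    IsRainbowNumber t (+ 1) b →
    IsRainbowNumber (s * t) (+ 1) c →
    c ≤ a + b ∸ 2
proposition3 s t 1≤s 1≤t a b c rbₛ@(1≤a , everyₛ , _) (1≤b , everyₜ , _) (_ , _ , c-minimal) =
  ≮⇒≥ λ r<c → c-minimal (a + b ∸ 2) 1≤r r<c every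
  where
  every : EveryColoringRainbow (s * t) (+ 1) (a + b ∸ 2)
  every = product-rainbow {{>-nonZero 1≤s}} {{>-nonZero 1≤t}} 1≤a 1≤b everyₛ everyₜ
  1≤r : 1 ≤ a + b ∸ 2
  1≤r = ∸-monoˡ-≤ 2 (+-mono-≤ (rainbowNumber≥2 {k = + 1} 1≤s rbₛ) 1≤b)
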